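{- Let $M$ be a mixed multigraph and let $V(M)=V_1\cup V_\omega\cup V_{\omega^2}\cup V_{\omega^3}\cup V_{\omega^4}\cup V_{\omega^5}$ be an admissible partition of its vertex set into six (possibly empty) sets. Then the mixed multigraph $M'$ obtained from $M$ by the three-way switching with respect to this partition is cospectral with $M$.
   Context: A mixed multigraph $M=(V,E,A)$ is a finite loopless multigraph in which each edge is either undirected or an arc directed from an initial vertex to a terminal vertex. Throughout, mixed multigraphs contain no digons: for any two adjacent vertices $u,v$, the edges between $u$ and $v$ consist of undirected edges together with arcs that all have the same direction. Let $\omega=\frac12+\frac{\sqrt3}{2}\mathsf{i}$ and $\mathfrak{W}=\{\omega^i:0\le i\le5\}$. The Hermitian adjacency matrix $N(M)=[N_{uv}]$ is defined by $N_{uv}=e\{u,v\}+e(u,v)\omega+e(v,u)\overline{\omega}$, where $e\{u,v\}$ is the number of undirected edges between $u$ and $v$ and $e(u,v)$ is the number of arcs directed from $u$ to $v$; two mixed multigraphs are cospectral if their Hermitian adjacency matrices have the same spectrum. A partition $V(M)=\bigcup_{j\in\mathfrak W}V_j$ is admissible if for each $j\in\mathfrak W$: (1) there are no arcs directed from $V_j$ to $V_{\omega j}$; (2) there are no edges (undirected or directed) with one endpoint in $V_j$ and the other in $V_{\omega^3 j}$; (3) all edges with one endpoint in $V_j$ and the other in $V_{\omega^4 j}$ are arcs directed from $V_j$ to $V_{\omega^4 j}$. The three-way switching with respect to an admissible partition changes $M$ into $M'$ by, for each $j\in\mathfrak W$: (a) replacing each undirected edge between $V_j$ and $V_{\omega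 j}$ by a single arc directed from $V_j$ to $V_{\omega j}$; (b) replacing each arc directed from $V_j$ to $V_{\omega^5 j}$ by a single undirected edge; (c) reversing the direction of every arc directed from $V_j$ to $V_{\omega^4 j}$; all other edges are unchanged. -}

module Defs where

open import Level using (Level)
open import Data.Nat as ℕ using (ℕ; zero; suc)
open import Data.Nat.DivMod using (_mod_)
open import Data.Integer as ℤ using (ℤ; +_)
open import Data.Fin as Fin using (Fin; zero; suc; toℕ; punchIn)
open import Data.Bool using (Bool; true; false; if_then_else_)
open import Data.List using (List; []; _∷_)
open import Data.Product using (_×_; _,_)
open import Data.Sum using (_⊎_)
open import Relation.Nullary using (does)
open import Relation.Binary.PropositionalEquality using (_≡_)
open import Algebra.Bundles.Raw using (RawRing)

-- Eisenstein integers ℤ[ω], ω = 1/2 + (√3/2) i, stored as a + bω.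
-- ω² = ω - 1,  ω̄ = 1 - ω.

record ℤω : Set where
  constructor _+_ω
  field
    re : ℤ
    im : ℤ
open ℤω public

infixl 6 _+ω_
infixl 7 _*ω_

_+ω_ : ℤω → ℤω → ℤω
(a + b ω) +ω (c + d ω) = (a ℤ.+ c) + (b ℤ.+ d) ω

-ω_ : ℤω → ℤω
-ω (a + b ω) = (ℤ.- a) + (ℤ.- b) ω

_*ω_ : ℤω → ℤω → ℤω
(a + b ω) *ω (c + d ω) = (a ℤ.* c ℤ.- b ℤ.* d) + (a ℤ.* d ℤ.+ b ℤ.* c ℤ.+ b ℤ.* d) ω

0ω 1ω ω ω̄ : ℤω
0ω = (+ 0) + (+ 0) ω
1ω = (+ 1) + (+ 0) ω
ω  = (+ 0) + (+ 1) ω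
ω̄  = (+ 1) + (ℤ.- (+ 1)) ω

nat : ℕ → ℤω
nat k = (+ k) + (+ 0) ω

-- Univariate polynomials over ℤ[ω] as coefficient lists (lowest degree
-- first); equality is coefficientwise.

Poly : Set
Poly = List ℤω

addP : Poly → Poly → Poly
addP []       q        = q
addP (a ∷ p)  []       = a ∷ p
addP (a ∷ p)  (b ∷ q)  = (a +ω b) ∷ addP p q

negP : Poly → Poly
negP []      = []
negP (a ∷ p) = (-ω a) ∷ negP p

scaleP : ℤω → Poly → Poly
scaleP c []      = []
scaleP c (a ∷ p) = (c *ω a) ∷ scaleP c p

mulP : Poly → Poly → Poly
mulP []      q = []
mulP (a ∷ p) q = addP (scaleP a q) (0ω ∷ mulP p q)

coeff : Poly → ℕ → ℤω
coeff []      _       = 0ω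
coeff (a ∷ p) zero    = a
coeff (a ∷ p) (suc k) = coeff p k

_≈P_ : Poly → Poly → Set
p ≈P q = ∀ k → coeff p k ≡ coeff q k

constP : ℤω → Poly
constP c = c ∷ []

X : Poly
X = 0ω ∷ 1ω ∷ []

PolyRing : RawRing _ _
PolyRing = record
  { Carrier = Poly ; _≈_ = _≈P_ ; _+_ = addP ; _*_ = mulP
  ; -_ = negP ; 0# = [] ; 1# = constP 1ω }

Matrix : ∀ {a} → Set a → ℕ → Set a
Matrix A n = Fin n → Fin n → A

module _ {c ℓ : Level} (R : RawRing c ℓ) where
  open RawRing R

  evenℕ : ℕ → Bool
  evenℕ zero          = true
  evenℕ (suc zero)    = false
  evenℕ (suc (suc k)) = evenℕ k

  sumFin : ∀ n → (Fin n → Carrier) → Carrier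
  sumFin zero    f = 0#
  sumFin (suc n) f = f zero + sumFin n (λ j → f (suc j))

  det : ∀ n → Matrix Carrier n → Carrier
  det zero    A = 1#
  det (suc n) A = sumFin (suc n) λ j →
    (if evenℕ (toℕ j) then 1# else - 1#) * (A zero j
      * det n (λ r s → A (suc r) (punchIn j s)))

-- Mixed multigraphs on the vertex set Fin n, given by edge multiplicities:
-- und u v = number of undirected edges between u and v,
-- arc u v = number of arcs directed from u to v.

record MixedMultigraph (n : ℕ) : Set where
  field
    und          : Fin n → Fin n → ℕ
    arc          : Fin n → Fin n → ℕ
    und-sym      : ∀ u v → und u v ≡ und v u
    und-loopless : ∀ u → und u u ≡ 0
    arc-loopless : ∀ u → arc u u ≡ 0
    no-digon     : ∀ u v → arc u v ≡ 0 ⊎ arc v u ≡ 0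
open MixedMultigraph public

hermAdj : ∀ {n} → (Fin n → Fin n → ℕ) → (Fin n → Fin n → ℕ) → Matrix ℤω n
hermAdj e a u v = nat (e u v) +ω nat (a u v) *ω ω +ω nat (a v u) *ω ω̄

N : ∀ {n} → MixedMultigraph n → Matrix ℤω n
N M = hermAdj (und M) (arc M)

charPoly : ∀ n → Matrix ℤω n → Poly
charPoly n A = det PolyRing n λ i j →
  if does (i Fin.≟ j) then addP X (negP (constP (A i j))) else negP (constP (A i j))

-- Two Hermitian matrices have the same spectrum (eigenvalues with
-- multiplicities) iff their characteristic polynomials coincide.
Cospectral : ∀ {n} → Matrix ℤω n → Matrix ℤω n → Set
Cospectral {n} A B = charPoly n A ≈P charPoly n B

-- Partitions V = ⋃_{j ∈ 𝔚} V_j encoded by p : Fin n → Fin 6, where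
-- p v = i means v ∈ V_{ω^i}.  diff i k = (k - i) mod 6, so that
-- v ∈ V_{ω^d j} for u ∈ V_j iff diff (p u) (p v) = d.

diff : Fin 6 → Fin 6 → Fin 6
diff i k = (toℕ k ℕ.+ (6 ℕ.∸ toℕ i)) mod 6

Admissible : ∀ {n} → MixedMultigraph n → (Fin n → Fin 6) → Set
Admissible M p = ∀ u v →
  -- (1) no arcs from V_j to V_{ωj}
  (diff (p u) (p v) ≡ suc zero → arc M u v ≡ 0) ×
  -- (2) no edges between V_j and V_{ω³j}
  (diff (p u) (p v) ≡ suc (suc (suc zero)) → und M u v ≡ 0 × arc M u v ≡ 0 × arc M v u ≡ 0) ×
  -- (3) all edges between V_j and V_{ω⁴j} are arcs from V_j to V_{ω⁴j}
  (diff (p u) (p v) ≡ suc (suc (suc (suc zero))) → und M u v ≡ 0 × arc M v u ≡ 0)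

switchArc : ∀ {n} → MixedMultigraph n → (Fin n → Fin 6) → Fin n → Fin n → ℕ
switchArc M p u v with diff (p u) (p v)
... | zero                          = arc M u v
... | suc zero                      = und M u v ℕ.+ arc M u v   -- (a), plus unchanged arcs
... | suc (suc zero)                = arc M u v ℕ.+ arc M v u   -- unchanged, plus (c) reversed
... | suc (suc (suc zero))          = arc M u v
... | suc (suc (suc (suc zero)))    = 0                         -- (c) reversed away
... | suc (suc (suc (suc (suc _)))) = 0                         -- (b) became undirected

switchUnd : ∀ {n} → MixedMultigraph n → (Fin n → Fin 6) → Fin n → Fin n → ℕ
switchUnd M p u v with diff (p u) (p v)
... | suc zero                      = arc M v u                 -- (b) arcs V_{ωj}→V_j
... | suc (suc (suc (suc (suc _)))) = arc M u v                 -- (b) arcs V_j→V_{ω⁵j}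
... | _                             = und M u v

switchN : ∀ {n} → MixedMultigraph n → (Fin n → Fin 6) → Matrix ℤω n
switchN M p = hermAdj (switchUnd M p) (switchArc M p)

-- Let D be the diagonal matrix with D_vv = ω^k for v ∈ V_{ω^k}. Admissibility guarantees that
-- the switching multiplies each entry N_uv by ω̄^{p(u)} ω^{p(v)}, so N(M') = D* N(M) D and
-- x I - N(M') = D* (x I - N(M)) D. Expanding along the first row, scaling the entries of a matrix
-- by u_i v_j multiplies its determinant by ∏ u · ∏ v, which is 1 here because ω̄^k ω^k = 1.

{-# OPTIONS --safe #-}
module Submission where

open import Defs
open import Algebra.Bundles using (CommutativeMonoid)
open import Algebra.Bundles.Raw using (RawRing)
open import Algebra.Structures using (IsCommutativeMonoid)
import Algebra.Properties.CommutativeMonoid.Sum as CommutativeMonoidSum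
import Algebra.Properties.CommutativeSemigroup as CommutativeSemigroupProperties
open import Data.Bool using (Bool; true; if_then_else_)
open import Data.Fin using (Fin; zero; suc; toℕ; punchIn; _≟_)
open import Data.Fin.Patterns using (0F; 1F; 2F; 3F; 4F; 5F)
open import Data.Fin.Properties using (all?)
open import Data.Nat as ℕ using (ℕ; zero; suc)
open import Data.Nat.GeneralisedArithmetic using (iterate)
open import Function using (_∘_)
open import Data.Integer as Int using (ℤ; +_)
open import Data.Integer.Tactic.RingSolver using (solve; solve-∀)
open import Data.List using ([]; _∷_)
open import Data.Product using (_×_; _,_; proj₁; proj₂)
open import Data.Unit using (⊤; tt)
open import Level using (0ℓ; _⊔_)
open import Relation.Binary.Bundles using (Setoid)
open import Relation.Binary.Definitions using (DecidableEquality)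
open import Relation.Binary.Structures using (IsEquivalence)
open import Relation.Binary.PropositionalEquality
  using (_≡_; refl; sym; trans; cong; cong₂; isEquivalence; module ≡-Reasoning)
import Relation.Binary.Reasoning.Setoid as SetoidReasoning
open import Relation.Nullary.Decidable using (yes; no; does; map′; _×-dec_; from-yes)

record IsScalarAction {c ℓ k ℓₖ} (R : RawRing c ℓ) (K : CommutativeMonoid k ℓₖ)
  (_•_ : CommutativeMonoid.Carrier K → RawRing.Carrier R → RawRing.Carrier R) : Set (c ⊔ ℓ ⊔ k ⊔ ℓₖ) where
  open RawRing R
  open CommutativeMonoid K using () renaming (_≈_ to _≈ₛ_; _∙_ to _·_; ε to 1ₛ)
  field
    ≈-isEquivalence : IsEquivalence _≈_
    +-cong          : ∀ {x x′ y y′} → x ≈ x′ → y ≈ y′ → x + y ≈ x′ + y′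
    *-cong          : ∀ {x x′ y y′} → x ≈ x′ → y ≈ y′ → x * y ≈ x′ * y′
    •-cong          : ∀ {a b x y} → a ≈ₛ b → x ≈ y → a • x ≈ b • y
    •-identityˡ     : ∀ x → 1ₛ • x ≈ x
    •-assoc         : ∀ a b x → (a · b) • x ≈ a • (b • x)
    •-zeroʳ         : ∀ a → a • 0# ≈ 0#
    •-distribˡ      : ∀ a x y → a • (x + y) ≈ a • x + a • y
    •-*-assoc       : ∀ a x y → (a • x) * y ≈ a • (x * y)
    *-•-comm        : ∀ a x y → x * (a • y) ≈ a • (x * y)

module DeterminantScaling
  {c ℓ k ℓₖ} {R : RawRing c ℓ} {K : CommutativeMonoid k ℓₖ}
  {_•_ : CommutativeMonoid.Carrier K → RawRing.Carrier R → RawRing.Carrier R}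
  (action : IsScalarAction R K _•_)
  where

  open RawRing R
  open CommutativeMonoid K using () renaming (Carrier to Scalar; _≈_ to _≈ₛ_; _∙_ to _·_; ε to 1ₛ)
  open IsScalarAction action

  private
    ≈-setoid : Setoid c ℓ
    ≈-setoid = record { isEquivalence = ≈-isEquivalence }
    module K = CommutativeMonoid K

  open Setoid ≈-setoid using () renaming (refl to ≈-refl; sym to ≈-sym; trans to ≈-trans)
  open SetoidReasoning ≈-setoid
  open CommutativeMonoidSum K using (sum-remove; ∑-distrib-+; sum-cong-≋; sum-replicate-zero)
    renaming (sum to ∏)
  open CommutativeSemigroupProperties K.commutativeSemigroup using (interchange)

  laplaceSign : ∀ {n} → Fin n → Carrier
  laplaceSign j = if evenℕ R (toℕ j) then 1# else - 1#

  sumFin-cong : ∀ n {f g : Fin n → Carrier} → (∀ j → f j ≈ g j) → sumFin R n f ≈ sumFin R n g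
  sumFin-cong zero    f≈g = ≈-refl
  sumFin-cong (suc n) f≈g = +-cong (f≈g zero) (sumFin-cong n (f≈g ∘ suc))

  •-distrib-sumFin : ∀ n a (f : Fin n → Carrier) → a • sumFin R n f ≈ sumFin R n (λ j → a • f j)
  •-distrib-sumFin zero    a f = •-zeroʳ a
  •-distrib-sumFin (suc n) a f =
    ≈-trans (•-distribˡ a _ _) (+-cong ≈-refl (•-distrib-sumFin n a (f ∘ suc)))

  det-cong : ∀ n {A B : Matrix Carrier n} → (∀ i j → A i j ≈ B i j) → det R n A ≈ det R n B
  det-cong zero    A≈B = ≈-refl
  det-cong (suc n) A≈B = sumFin-cong (suc n) λ j →
    *-cong (≈-refl {laplaceSign j}) (*-cong (A≈B zero j) (det-cong n λ r s → A≈B (suc r) (punchIn j s)))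

  det-scale : ∀ n (u v : Fin n → Scalar) (B : Matrix Carrier n) →
              det R n (λ i j → (u i · v j) • B i j) ≈ (∏ u · ∏ v) • det R n B
  det-scale zero    u v B = ≈-sym (≈-trans (•-cong (K.identityˡ 1ₛ) ≈-refl) (•-identityˡ 1#))
  det-scale (suc n) u v B = begin
    sumFin R (suc n) (λ j → laplaceSign j * (((u zero · v j) • B zero j) * det R n (minor′ j)))
      ≈⟨ sumFin-cong (suc n) expand ⟩
    sumFin R (suc n) (λ j → (∏ u · ∏ v) • (laplaceSign j * (B zero j * det R n (minor j))))
      ≈⟨ •-distrib-sumFin (suc n) (∏ u · ∏ v) (λ j → laplaceSign j * (B zero j * det R n (minor j))) ⟨
    (∏ u · ∏ v) • det R (suc n) B ∎
    where
    minor minor′ : Fin (suc n) → Matrix Carrier n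
    minor  j r s = B (suc r) (punchIn j s)
    minor′ j r s = (u (suc r) · v (punchIn j s)) • minor j r s
    expand : ∀ j → laplaceSign j * (((u zero · v j) • B zero j) * det R n (minor′ j))
                 ≈ (∏ u · ∏ v) • (laplaceSign j * (B zero j * det R n (minor j)))
    expand j = begin
      laplaceSign j * ((a • B zero j) * det R n (minor′ j))
        ≈⟨ *-cong ≈-refl (*-cong ≈-refl (det-scale n (u ∘ suc) (v ∘ punchIn j) (minor j))) ⟩
      laplaceSign j * ((a • B zero j) * (b • det R n (minor j)))
        ≈⟨ *-cong ≈-refl (•-*-assoc a _ _) ⟩
      laplaceSign j * (a • (B zero j * (b • det R n (minor j))))
        ≈⟨ *-cong ≈-refl (•-cong K.refl (*-•-comm b _ _)) ⟩
      laplaceSign j * (a • (b • (B zero j * det R n (minor j))))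
        ≈⟨ *-cong ≈-refl (•-assoc a b _) ⟨
      laplaceSign j * ((a · b) • (B zero j * det R n (minor j)))
        ≈⟨ *-•-comm (a · b) _ _ ⟩
      (a · b) • (laplaceSign j * (B zero j * det R n (minor j)))
        ≈⟨ •-cong scalars ≈-refl ⟩
      (∏ u · ∏ v) • (laplaceSign j * (B zero j * det R n (minor j))) ∎
      where
      a b : Scalar
      a = u zero · v j
      b = ∏ (u ∘ suc) · ∏ (v ∘ punchIn j)
      scalars : a · b ≈ₛ ∏ u · ∏ v
      scalars = K.trans (interchange (u zero) (v j) _ _) (K.∙-congˡ (K.sym (sum-remove v)))

  det-conjugate : ∀ n (u v : Fin n → Scalar) (B : Matrix Carrier n) → (∀ i → u i · v i ≈ₛ 1ₛ) →
                  det R n (λ i j → (u i · v j) • B i j) ≈ det R n B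
  det-conjugate n u v B uv≈1 =
    ≈-trans (det-scale n u v B) (≈-trans (•-cong ∏u·∏v≈1 ≈-refl) (•-identityˡ (det R n B)))
    where
    ∏u·∏v≈1 : ∏ u · ∏ v ≈ₛ 1ₛ
    ∏u·∏v≈1 = K.trans (K.sym (∑-distrib-+ u v)) (K.trans (sum-cong-≋ uv≈1) (sum-replicate-zero n))

infix 4 _≟ω_

_≟ω_ : DecidableEquality ℤω
(a + b ω) ≟ω (c + d ω) =
  map′ (λ (a≡c , b≡d) → cong₂ _+_ω a≡c b≡d) (λ eq → cong re eq , cong im eq) (a Int.≟ c ×-dec b Int.≟ d)

+ω-identityˡ : ∀ x → 0ω +ω x ≡ x
+ω-identityˡ (a + b ω) = cong₂ _+_ω (solve (a ∷ [])) (solve (b ∷ []))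

+ω-identityʳ : ∀ x → x +ω 0ω ≡ x
+ω-identityʳ (a + b ω) = cong₂ _+_ω (solve (a ∷ [])) (solve (b ∷ []))

*ω-identityˡ : ∀ x → 1ω *ω x ≡ x
*ω-identityˡ (a + b ω) = cong₂ _+_ω (solve (a ∷ b ∷ [])) (solve (a ∷ b ∷ []))

*ω-zeroˡ : ∀ x → 0ω *ω x ≡ 0ω
*ω-zeroˡ (a + b ω) = cong₂ _+_ω (solve (a ∷ b ∷ [])) (solve (a ∷ b ∷ []))

*ω-zeroʳ : ∀ x → x *ω 0ω ≡ 0ω
*ω-zeroʳ (a + b ω) = cong₂ _+_ω (solve (a ∷ b ∷ [])) (solve (a ∷ b ∷ []))

*ω-comm : ∀ x y → x *ω y ≡ y *ω x
*ω-comm (a + b ω) (c + d ω) = cong₂ _+_ω (solve (a ∷ b ∷ c ∷ d ∷ [])) (solve (a ∷ b ∷ c ∷ d ∷ []))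

*ω-identityʳ : ∀ x → x *ω 1ω ≡ x
*ω-identityʳ x = trans (*ω-comm x 1ω) (*ω-identityˡ x)

*ω-assoc : ∀ x y z → (x *ω y) *ω z ≡ x *ω (y *ω z)
*ω-assoc (a + b ω) (c + d ω) (e + f ω) = cong₂ _+_ω (re-assoc a b c d e f) (im-assoc a b c d e f)
  where
  open Int using (_+_; _-_; _*_)
  re-assoc : ∀ a b c d e f →
    (a * c - b * d) * e - (a * d + b * c + b * d) * f
      ≡ a * (c * e - d * f) - b * (c * f + d * e + d * f)
  re-assoc = solve-∀
  im-assoc : ∀ a b c d e f →
    (a * c - b * d) * f + (a * d + b * c + b * d) * e + (a * d + b * c + b * d) * f
      ≡ a * (c * f + d * e + d * f) + b * (c * e - d * f) + b * (c * f + d * e + d * f)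
  im-assoc = solve-∀

*ω-distribˡ-+ω : ∀ x y z → x *ω (y +ω z) ≡ x *ω y +ω x *ω z
*ω-distribˡ-+ω (a + b ω) (c + d ω) (e + f ω) = cong₂ _+_ω (re-distrib a b c d e f) (im-distrib a b c d e f)
  where
  open Int using (_+_; _-_; _*_)
  re-distrib : ∀ a b c d e f → a * (c + e) - b * (d + f) ≡ (a * c - b * d) + (a * e - b * f)
  re-distrib = solve-∀
  im-distrib : ∀ a b c d e f →
    a * (d + f) + b * (c + e) + b * (d + f) ≡ (a * d + b * c + b * d) + (a * f + b * e + b * f)
  im-distrib = solve-∀

-ω‿distribʳ-*ω : ∀ x y → -ω (x *ω y) ≡ x *ω (-ω y)
-ω‿distribʳ-*ω (a + b ω) (c + d ω) = cong₂ _+_ω (re-neg a b c d) (im-neg a b c d)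
  where
  open Int using (_+_; _-_; _*_; -_)
  re-neg : ∀ a b c d → - (a * c - b * d) ≡ a * (- c) - b * (- d)
  re-neg = solve-∀
  im-neg : ∀ a b c d → - (a * d + b * c + b * d) ≡ a * (- d) + b * (- c) + b * (- d)
  im-neg = solve-∀

*ω-isCommutativeMonoid : IsCommutativeMonoid _≡_ _*ω_ 1ω
*ω-isCommutativeMonoid = record
  { isMonoid = record
    { isSemigroup = record { isMagma = record { isEquivalence = isEquivalence ; ∙-cong = cong₂ _*ω_ }
                           ; assoc = *ω-assoc }
    ; identity = *ω-identityˡ , *ω-identityʳ }
  ; comm = *ω-comm }

*ω-commutativeMonoid : CommutativeMonoid 0ℓ 0ℓ
*ω-commutativeMonoid = record { isCommutativeMonoid = *ω-isCommutativeMonoid }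

open CommutativeSemigroupProperties (CommutativeMonoid.commutativeSemigroup *ω-commutativeMonoid)
  using (x∙yz≈y∙xz)

≈P-isEquivalence : IsEquivalence _≈P_
≈P-isEquivalence = record
  { refl  = λ _ → refl
  ; sym   = λ p≈q k → sym (p≈q k)
  ; trans = λ p≈q q≈r k → trans (p≈q k) (q≈r k)
  }

≈P-setoid : Setoid 0ℓ 0ℓ
≈P-setoid = record { isEquivalence = ≈P-isEquivalence }

coeff-addP : ∀ p q k → coeff (addP p q) k ≡ coeff p k +ω coeff q k
coeff-addP []      q       k       = sym (+ω-identityˡ (coeff q k))
coeff-addP (a ∷ p) []      k       = sym (+ω-identityʳ (coeff (a ∷ p) k))
coeff-addP (a ∷ p) (b ∷ q) zero    = refl
coeff-addP (a ∷ p) (b ∷ q) (suc k) = coeff-addP p q k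

coeff-scaleP : ∀ a p k → coeff (scaleP a p) k ≡ a *ω coeff p k
coeff-scaleP a []      k       = sym (*ω-zeroʳ a)
coeff-scaleP a (b ∷ p) zero    = refl
coeff-scaleP a (b ∷ p) (suc k) = coeff-scaleP a p k

coeff-negP : ∀ p k → coeff (negP p) k ≡ -ω coeff p k
coeff-negP []      k       = refl
coeff-negP (b ∷ p) zero    = refl
coeff-negP (b ∷ p) (suc k) = coeff-negP p k

convolve : (ℕ → ℤω) → (ℕ → ℤω) → ℕ → ℤω
convolve f g zero    = f 0 *ω g 0
convolve f g (suc k) = f 0 *ω g (suc k) +ω convolve (f ∘ suc) g k

convolve-cong : ∀ {f f′ g g′} → (∀ i → f i ≡ f′ i) → (∀ i → g i ≡ g′ i) →
                ∀ k → convolve f g k ≡ convolve f′ g′ k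
convolve-cong f≡f′ g≡g′ zero    = cong₂ _*ω_ (f≡f′ 0) (g≡g′ 0)
convolve-cong f≡f′ g≡g′ (suc k) =
  cong₂ _+ω_ (cong₂ _*ω_ (f≡f′ 0) (g≡g′ (suc k))) (convolve-cong (f≡f′ ∘ suc) g≡g′ k)

convolve-zeroˡ : ∀ g k → convolve (λ _ → 0ω) g k ≡ 0ω
convolve-zeroˡ g zero    = *ω-zeroˡ (g 0)
convolve-zeroˡ g (suc k) = cong₂ _+ω_ (*ω-zeroˡ (g (suc k))) (convolve-zeroˡ g k)

convolve-scaleˡ : ∀ a f g k → convolve (λ i → a *ω f i) g k ≡ a *ω convolve f g k
convolve-scaleˡ a f g zero    = *ω-assoc a (f 0) (g 0)
convolve-scaleˡ a f g (suc k) =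
  trans (cong₂ _+ω_ (*ω-assoc a (f 0) (g (suc k))) (convolve-scaleˡ a (f ∘ suc) g k))
        (sym (*ω-distribˡ-+ω a _ _))

convolve-scaleʳ : ∀ a f g k → convolve f (λ i → a *ω g i) k ≡ a *ω convolve f g k
convolve-scaleʳ a f g zero    = x∙yz≈y∙xz (f 0) a (g 0)
convolve-scaleʳ a f g (suc k) =
  trans (cong₂ _+ω_ (x∙yz≈y∙xz (f 0) a (g (suc k))) (convolve-scaleʳ a (f ∘ suc) g k))
        (sym (*ω-distribˡ-+ω a _ _))

coeff-mulP : ∀ p q k → coeff (mulP p q) k ≡ convolve (coeff p) (coeff q) k
coeff-mulP []      q k = sym (convolve-zeroˡ (coeff q) k)
coeff-mulP (a ∷ p) q k = trans (coeff-addP (scaleP a q) (0ω ∷ mulP p q) k) (split k)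
  where
  split : ∀ k → coeff (scaleP a q) k +ω coeff (0ω ∷ mulP p q) k ≡ convolve (coeff (a ∷ p)) (coeff q) k
  split zero    = trans (+ω-identityʳ _) (coeff-scaleP a q 0)
  split (suc k) = cong₂ _+ω_ (coeff-scaleP a q (suc k)) (coeff-mulP p q k)

scaleP-identityˡ : ∀ p → scaleP 1ω p ≈P p
scaleP-identityˡ p k = trans (coeff-scaleP 1ω p k) (*ω-identityˡ (coeff p k))

scaleP-assoc : ∀ a b p → scaleP (a *ω b) p ≈P scaleP a (scaleP b p)
scaleP-assoc a b p k = begin
  coeff (scaleP (a *ω b) p) k   ≡⟨ coeff-scaleP (a *ω b) p k ⟩
  (a *ω b) *ω coeff p k         ≡⟨ *ω-assoc a b (coeff p k) ⟩
  a *ω (b *ω coeff p k)         ≡⟨ cong (a *ω_) (coeff-scaleP b p k) ⟨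
  a *ω coeff (scaleP b p) k     ≡⟨ coeff-scaleP a (scaleP b p) k ⟨
  coeff (scaleP a (scaleP b p)) k ∎
  where open ≡-Reasoning

scaleP-distribˡ-addP : ∀ a p q → scaleP a (addP p q) ≈P addP (scaleP a p) (scaleP a q)
scaleP-distribˡ-addP a p q k = begin
  coeff (scaleP a (addP p q)) k                 ≡⟨ coeff-scaleP a (addP p q) k ⟩
  a *ω coeff (addP p q) k                       ≡⟨ cong (a *ω_) (coeff-addP p q k) ⟩
  a *ω (coeff p k +ω coeff q k)                 ≡⟨ *ω-distribˡ-+ω a (coeff p k) (coeff q k) ⟩
  a *ω coeff p k +ω a *ω coeff q k              ≡⟨ cong₂ _+ω_ (coeff-scaleP a p k) (coeff-scaleP a q k) ⟨
  coeff (scaleP a p) k +ω coeff (scaleP a q) k  ≡⟨ coeff-addP (scaleP a p) (scaleP a q) k ⟨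
  coeff (addP (scaleP a p) (scaleP a q)) k      ∎
  where open ≡-Reasoning

mulP-scalePˡ : ∀ a p q → mulP (scaleP a p) q ≈P scaleP a (mulP p q)
mulP-scalePˡ a p q k = begin
  coeff (mulP (scaleP a p) q) k                     ≡⟨ coeff-mulP (scaleP a p) q k ⟩
  convolve (coeff (scaleP a p)) (coeff q) k         ≡⟨ convolve-cong (coeff-scaleP a p) (λ _ → refl) k ⟩
  convolve (λ i → a *ω coeff p i) (coeff q) k       ≡⟨ convolve-scaleˡ a (coeff p) (coeff q) k ⟩
  a *ω convolve (coeff p) (coeff q) k               ≡⟨ cong (a *ω_) (coeff-mulP p q k) ⟨
  a *ω coeff (mulP p q) k                           ≡⟨ coeff-scaleP a (mulP p q) k ⟨
  coeff (scaleP a (mulP p q)) k                     ∎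
  where open ≡-Reasoning

mulP-scalePʳ : ∀ a p q → mulP p (scaleP a q) ≈P scaleP a (mulP p q)
mulP-scalePʳ a p q k = begin
  coeff (mulP p (scaleP a q)) k                     ≡⟨ coeff-mulP p (scaleP a q) k ⟩
  convolve (coeff p) (coeff (scaleP a q)) k         ≡⟨ convolve-cong (λ _ → refl) (coeff-scaleP a q) k ⟩
  convolve (coeff p) (λ i → a *ω coeff q i) k       ≡⟨ convolve-scaleʳ a (coeff p) (coeff q) k ⟩
  a *ω convolve (coeff p) (coeff q) k               ≡⟨ cong (a *ω_) (coeff-mulP p q k) ⟨
  a *ω coeff (mulP p q) k                           ≡⟨ coeff-scaleP a (mulP p q) k ⟨
  coeff (scaleP a (mulP p q)) k                     ∎
  where open ≡-Reasoning

negP-scaleP : ∀ a p → negP (scaleP a p) ≈P scaleP a (negP p)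
negP-scaleP a p k = begin
  coeff (negP (scaleP a p)) k   ≡⟨ coeff-negP (scaleP a p) k ⟩
  -ω coeff (scaleP a p) k       ≡⟨ cong -ω_ (coeff-scaleP a p k) ⟩
  -ω (a *ω coeff p k)           ≡⟨ -ω‿distribʳ-*ω a (coeff p k) ⟩
  a *ω (-ω coeff p k)           ≡⟨ cong (a *ω_) (coeff-negP p k) ⟨
  a *ω coeff (negP p) k         ≡⟨ coeff-scaleP a (negP p) k ⟨
  coeff (scaleP a (negP p)) k   ∎
  where open ≡-Reasoning

scaleP-isScalarAction : IsScalarAction PolyRing *ω-commutativeMonoid scaleP
scaleP-isScalarAction = record
  { ≈-isEquivalence = ≈P-isEquivalence
  ; +-cong          = λ {p p′ q q′} p≈p′ q≈q′ k →
      trans (coeff-addP p q k) (trans (cong₂ _+ω_ (p≈p′ k) (q≈q′ k)) (sym (coeff-addP p′ q′ k)))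
  ; *-cong          = λ {p p′ q q′} p≈p′ q≈q′ k →
      trans (coeff-mulP p q k) (trans (convolve-cong p≈p′ q≈q′ k) (sym (coeff-mulP p′ q′ k)))
  ; •-cong          = λ {a b p q} a≡b p≈q k →
      trans (coeff-scaleP a p k) (trans (cong₂ _*ω_ a≡b (p≈q k)) (sym (coeff-scaleP b q k)))
  ; •-identityˡ     = scaleP-identityˡ
  ; •-assoc         = scaleP-assoc
  ; •-zeroʳ         = λ _ _ → refl
  ; •-distribˡ      = scaleP-distribˡ-addP
  ; •-*-assoc       = mulP-scalePˡ
  ; *-•-comm        = mulP-scalePʳ
  }

open DeterminantScaling scaleP-isScalarAction using (det-cong; det-conjugate)

charEntry : Bool → ℤω → Poly
charEntry onDiagonal a = if onDiagonal then addP X (negP (constP a)) else negP (constP a)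

charMatrix : ∀ {n} → Matrix ℤω n → Matrix Poly n
charMatrix A i j = charEntry (does (i ≟ j)) (A i j)

charPoly-cong : ∀ {n} {A B : Matrix ℤω n} → (∀ i j → A i j ≡ B i j) → Cospectral A B
charPoly-cong {n} A≡B = det-cong n λ i j k → cong (λ a → coeff (charEntry (does (i ≟ j)) a) k) (A≡B i j)

charMatrix-conjugate : ∀ {n} (A : Matrix ℤω n) (u v : Fin n → ℤω) → (∀ i → u i *ω v i ≡ 1ω) →
  ∀ i j → charMatrix (λ i j → (u i *ω v j) *ω A i j) i j ≈P scaleP (u i *ω v j) (charMatrix A i j)
charMatrix-conjugate A u v uv≡1 i j with i ≟ j
... | yes refl = diagonal (A i i) (uv≡1 i)
  where
  diagonal : ∀ {c} a → c ≡ 1ω → charEntry true (c *ω a) ≈P scaleP c (charEntry true a)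
  diagonal a refl = begin
    charEntry true (1ω *ω a)         ≡⟨ cong (charEntry true) (*ω-identityˡ a) ⟩
    charEntry true a                 ≈⟨ scaleP-identityˡ (charEntry true a) ⟨
    scaleP 1ω (charEntry true a)     ∎
    where open SetoidReasoning ≈P-setoid
... | no _ = negP-scaleP (u i *ω v j) (constP (A i j))

charPoly-conjugate : ∀ {n} (A : Matrix ℤω n) (u v : Fin n → ℤω) → (∀ i → u i *ω v i ≡ 1ω) →
                     Cospectral A (λ i j → (u i *ω v j) *ω A i j)
charPoly-conjugate {n} A u v uv≡1 = begin
  charPoly n A
    ≈⟨ det-conjugate n u v (charMatrix A) uv≡1 ⟨
  det PolyRing n (λ i j → scaleP (u i *ω v j) (charMatrix A i j))
    ≈⟨ det-cong n (charMatrix-conjugate A u v uv≡1) ⟨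
  charPoly n (λ i j → (u i *ω v j) *ω A i j) ∎
  where open SetoidReasoning ≈P-setoid

-- a + b ω̄, using ω̄ = 1 - ω.
conj : ℤω → ℤω
conj (a + b ω) = (a Int.+ b) + (Int.- b) ω

infix 8 ω^_ -₆_

ω^_ : Fin 6 → ℤω
ω^ k = iterate (ω *ω_) 1ω (toℕ k)

-₆_ : Fin 6 → Fin 6
-₆ d = diff d 0F

diff-swap : ∀ a b → diff b a ≡ -₆ diff a b
diff-swap = from-yes (all? λ a → all? λ b → diff b a ≟ -₆ diff a b)

conj-ω^-*ω-ω^ : ∀ a b → conj (ω^ a) *ω ω^ b ≡ ω^ diff a b
conj-ω^-*ω-ω^ = from-yes (all? λ a → all? λ b → conj (ω^ a) *ω ω^ b ≟ω ω^ diff a b)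

conj-ω^-inverse : ∀ a → conj (ω^ a) *ω ω^ a ≡ 1ω
conj-ω^-inverse = from-yes (all? λ a → conj (ω^ a) *ω ω^ a ≟ω 1ω)

hermitianEntry : ℤ → ℤ → ℤ → ℤω
hermitianEntry x y z = (x Int.+ z) + (y Int.- z) ω

hermitianEntry-cong : ∀ {x x′ y y′ z z′} → x ≡ x′ → y ≡ y′ → z ≡ z′ →
                      hermitianEntry (+ x) (+ y) (+ z) ≡ hermitianEntry (+ x′) (+ y′) (+ z′)
hermitianEntry-cong refl refl refl = refl

hermAdj-≡-hermitianEntry : ∀ {n} (e a : Fin n → Fin n → ℕ) u v →
                           hermAdj e a u v ≡ hermitianEntry (+ e u v) (+ a u v) (+ a v u)
hermAdj-≡-hermitianEntry e a u v = cong₂ _+_ω (re-identity (+ e u v) (+ a u v) (+ a v u))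
                                        (im-identity (+ e u v) (+ a u v) (+ a v u))
  where
  open Int using (_+_; _-_; _*_; 0ℤ; 1ℤ; -1ℤ)
  re-identity : ∀ x y z → (x + (y * 0ℤ - 0ℤ * 1ℤ)) + (z * 1ℤ - 0ℤ * -1ℤ) ≡ x + z
  re-identity = solve-∀
  im-identity : ∀ x y z → (0ℤ + (y * 1ℤ + 0ℤ * 0ℤ + 0ℤ * 1ℤ)) + (z * -1ℤ + 0ℤ * 1ℤ + 0ℤ * -1ℤ) ≡ y - z
  im-identity = solve-∀

-- With d = diff (p u) (p v) and (e , a , b) = (e{u,v} , e(u,v) , e(v,u)), these are the
-- multiplicities of the switched multigraph between u and v.
switchedUnd switchedArc : Fin 6 → ℕ → ℕ → ℕ → ℕ
switchedUnd 0F e a b = e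
switchedUnd 1F e a b = b
switchedUnd 2F e a b = e
switchedUnd 3F e a b = e
switchedUnd 4F e a b = e
switchedUnd 5F e a b = a

switchedArc 0F e a b = a
switchedArc 1F e a b = e ℕ.+ a
switchedArc 2F e a b = a ℕ.+ b
switchedArc 3F e a b = a
switchedArc 4F e a b = 0
switchedArc 5F e a b = 0

switchUnd-≡ : ∀ {n} (M : MixedMultigraph n) p u v →
  switchUnd M p u v ≡ switchedUnd (diff (p u) (p v)) (und M u v) (arc M u v) (arc M v u)
switchUnd-≡ M p u v with diff (p u) (p v)
... | 0F = refl
... | 1F = refl
... | 2F = refl
... | 3F = refl
... | 4F = refl
... | 5F = refl

switchArc-≡ : ∀ {n} (M : MixedMultigraph n) p u v →
  switchArc M p u v ≡ switchedArc (diff (p u) (p v)) (und M u v) (arc M u v) (arc M v u)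
switchArc-≡ M p u v with diff (p u) (p v)
... | 0F = refl
... | 1F = refl
... | 2F = refl
... | 3F = refl
... | 4F = refl
... | 5F = refl

-- For d = 2 and d = 5 these are conditions (3) and (1) of admissibility seen from v.
AdmissibleAt : Fin 6 → ℕ → ℕ → ℕ → Set
AdmissibleAt 0F e a b = ⊤
AdmissibleAt 1F e a b = a ≡ 0
AdmissibleAt 2F e a b = e ≡ 0 × a ≡ 0
AdmissibleAt 3F e a b = e ≡ 0 × a ≡ 0 × b ≡ 0
AdmissibleAt 4F e a b = e ≡ 0 × b ≡ 0
AdmissibleAt 5F e a b = b ≡ 0

Admissible⇒AdmissibleAt : ∀ {n} (M : MixedMultigraph n) p → Admissible M p → ∀ u v →
  AdmissibleAt (diff (p u) (p v)) (und M u v) (arc M u v) (arc M v u)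
Admissible⇒AdmissibleAt M p adm u v with diff (p u) (p v) in eq
... | 0F = tt
... | 1F = proj₁ (adm u v) eq
... | 2F = let und≡0 , arc≡0 = proj₂ (proj₂ (adm v u)) (trans (diff-swap (p u) (p v)) (cong -₆_ eq))
           in trans (und-sym M u v) und≡0 , arc≡0
... | 3F = proj₁ (proj₂ (adm u v)) eq
... | 4F = proj₂ (proj₂ (adm u v)) eq
... | 5F = proj₁ (adm v u) (trans (diff-swap (p u) (p v)) (cong -₆_ eq))

-- In coordinates (re , im): ω = (0 , 1), ω² = (-1 , 1), ω³ = (-1 , 0), ω⁴ = (0 , -1), ω⁵ = (1 , -1).
switchedEntry : ∀ d e a b → AdmissibleAt d e a b →
  hermitianEntry (+ switchedUnd d e a b) (+ switchedArc d e a b) (+ switchedArc (-₆ d) e b a)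
    ≡ ω^ d *ω hermitianEntry (+ e) (+ a) (+ b)
switchedEntry 0F e a b _ = sym (*ω-identityˡ (hermitianEntry (+ e) (+ a) (+ b)))
switchedEntry 1F e .0 b refl = cong₂ _+_ω (re-identity (+ e) (+ b)) (im-identity (+ e) (+ b))
  where
  open Int using (_+_; _-_; _*_; 0ℤ; 1ℤ)
  re-identity : ∀ x z → z + 0ℤ ≡ 0ℤ * (x + z) - 1ℤ * (0ℤ - z)
  re-identity = solve-∀
  im-identity : ∀ x z → (x + 0ℤ) - 0ℤ ≡ 0ℤ * (0ℤ - z) + 1ℤ * (x + z) + 1ℤ * (0ℤ - z)
  im-identity = solve-∀
switchedEntry 2F .0 .0 b (refl , refl) = cong₂ _+_ω (re-identity (+ b)) (im-identity (+ b))
  where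
  open Int using (_+_; _-_; _*_; 0ℤ; 1ℤ; -1ℤ)
  re-identity : ∀ z → 0ℤ + 0ℤ ≡ -1ℤ * (0ℤ + z) - 1ℤ * (0ℤ - z)
  re-identity = solve-∀
  im-identity : ∀ z → z - 0ℤ ≡ -1ℤ * (0ℤ - z) + 1ℤ * (0ℤ + z) + 1ℤ * (0ℤ - z)
  im-identity = solve-∀
switchedEntry 3F .0 .0 .0 (refl , refl , refl) = refl
switchedEntry 4F .0 a .0 (refl , refl) = cong₂ _+_ω (re-identity (+ a)) (im-identity (+ a))
  where
  open Int using (_+_; _-_; _*_; 0ℤ; -1ℤ)
  re-identity : ∀ y → 0ℤ + y ≡ 0ℤ * (0ℤ + 0ℤ) - -1ℤ * (y - 0ℤ)
  re-identity = solve-∀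
  im-identity : ∀ y → 0ℤ - y ≡ 0ℤ * (y - 0ℤ) + -1ℤ * (0ℤ + 0ℤ) + -1ℤ * (y - 0ℤ)
  im-identity = solve-∀
switchedEntry 5F e a .0 refl = cong₂ _+_ω (re-identity (+ e) (+ a)) (im-identity (+ e) (+ a))
  where
  open Int using (_+_; _-_; _*_; 0ℤ; 1ℤ; -1ℤ)
  re-identity : ∀ x y → y + (x + 0ℤ) ≡ 1ℤ * (x + 0ℤ) - -1ℤ * (y - 0ℤ)
  re-identity = solve-∀
  im-identity : ∀ x y → 0ℤ - (x + 0ℤ) ≡ 1ℤ * (y - 0ℤ) + -1ℤ * (x + 0ℤ) + -1ℤ * (y - 0ℤ)
  im-identity = solve-∀

switchN-entry : ∀ {n} (M : MixedMultigraph n) p → Admissible M p → ∀ u v →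
                switchN M p u v ≡ (conj (ω^ p u) *ω ω^ p v) *ω N M u v
switchN-entry M p adm u v = begin
  switchN M p u v
    ≡⟨ hermAdj-≡-hermitianEntry (switchUnd M p) (switchArc M p) u v ⟩
  hermitianEntry (+ switchUnd M p u v) (+ switchArc M p u v) (+ switchArc M p v u)
    ≡⟨ hermitianEntry-cong (switchUnd-≡ M p u v) (switchArc-≡ M p u v) reversedArcs ⟩
  hermitianEntry (+ switchedUnd d e a b) (+ switchedArc d e a b) (+ switchedArc (-₆ d) e b a)
    ≡⟨ switchedEntry d e a b (Admissible⇒AdmissibleAt M p adm u v) ⟩
  ω^ d *ω hermitianEntry (+ e) (+ a) (+ b)
    ≡⟨ cong₂ _*ω_ (conj-ω^-*ω-ω^ (p u) (p v)) (hermAdj-≡-hermitianEntry (und M) (arc M) u v) ⟨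
  (conj (ω^ p u) *ω ω^ p v) *ω N M u v ∎
  where
  open ≡-Reasoning
  d : Fin 6
  d = diff (p u) (p v)
  e a b : ℕ
  e = und M u v
  a = arc M u v
  b = arc M v u
  reversedArcs : switchArc M p v u ≡ switchedArc (-₆ d) e b a
  reversedArcs = trans (switchArc-≡ M p v u)
                       (cong₂ (λ d′ e′ → switchedArc d′ e′ b a) (diff-swap (p u) (p v)) (und-sym M v u))

theorem3p6 : ∀ {n : ℕ} (M : MixedMultigraph n) (p : Fin n → Fin 6) →
    Admissible M p → Cospectral (N M) (switchN M p)
theorem3p6 {n} M p adm = begin
  charPoly n (N M)
    ≈⟨ charPoly-conjugate (N M) (λ u → conj (ω^ p u)) (λ v → ω^ p v) (λ u → conj-ω^-inverse (p u)) ⟩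
  charPoly n (λ u v → (conj (ω^ p u) *ω ω^ p v) *ω N M u v)
    ≈⟨ charPoly-cong (switchN-entry M p adm) ⟨
  charPoly n (switchN M p) ∎
  where open SetoidReasoning ≈P-setoid
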